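{- Let $h \geq 3$ be an integer and let $A = \{a_1, \ldots, a_{h+1}\}$ be a set of positive integers with $a_1 < \cdots < a_{h+1}$. Assume $a_1 \not\equiv a_2 \pmod 2$ and $a_1 \not\equiv a_3 \pmod 2$. Let $A_1 = A \setminus \{a_1\}$. Then \[|h^{\wedge}_{\pm}A| \geq \begin{cases} |h^{\wedge}_{\pm}A_1| + \frac{h(h+1)}{2} + 2h - 1, & \text{if } a_3 = 2a_1 + a_2,\\ |h^{\wedge}_{\pm}A_1| + \frac{h(h+1)}{2} + 3h - 2, & \text{if } a_3 \neq 2a_1 + a_2, \end{cases}\] and consequently \[|h^{\wedge}_{\pm}A| \geq \begin{cases} h^2 + 3h, & \text{if } a_3 = 2a_1 + a_2,\\ h^2 + 4h - 1, & \text{if } a_3 \neq 2a_1 + a_2. \end{cases}\]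
   Context: For a finite set $A = \{a_1, \ldots, a_k\}$ of integers (with distinct $a_i$) and a positive integer $h$, the restricted $h$-fold signed sumset is \[h^{\wedge}_{\pm}A = \left\{ \sum_{i=1}^{k} \lambda_i a_i : \lambda_i \in \{ -1,0,1\}, \ \sum_{i=1}^{k} |\lambda_i| = h \right\}.\] -}

module Defs where

open import Data.Nat using (ℕ; zero; suc)
open import Data.Integer using (ℤ; +_; _+_; -_)
open import Data.Integer.Properties using (_≟_)
open import Data.List using (List; []; _∷_; _++_; map; length; deduplicate)

-- All sums  Σ λᵢ aᵢ  with λᵢ ∈ {-1,0,1} and exactly h nonzero λᵢ,
-- as a list (with possible repetitions), for A given as a list of its elements.
signedSums : List ℤ → ℕ → List ℤ
signedSums []       zero    = + 0 ∷ []
signedSums []       (suc h) = []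
signedSums (a ∷ as) zero    = signedSums as zero
signedSums (a ∷ as) (suc h) =
  signedSums as (suc h) ++ (map (λ s → a + s) (signedSums as h) ++ map (λ s → (- a) + s) (signedSums as h))

restrictedSignedSumsetSize : ℕ → List ℤ → ℕ
restrictedSignedSumsetSize h A = length (deduplicate _≟_ (signedSums A h))

-- Since |A₁| = h, every element of h^∧_± A₁ is a signed sum of all of A₁ and so has the parity
-- of ΣA₁.  A signed sum of a₁, one of a₂, a₃ and all later elements has the parity of
-- ΣA₁ + a₁ − a₂, the other one; so all such sums are new, and it suffices to count them.
-- Write them as M − 2η with M = a₁ + a₃ + a₄ + ⋯ + a_{h+1}.  For a₁, a₂, a₃ alone, with
-- a₃ = a₂ + 2t, six of the eight sums ±a₁ ± a₂, ±a₁ ± a₃ have the distinct η 0, t, t + a₁,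
-- a₂ + t, a₂ + t + a₁, a₃ + a₁, and −a₁ + a₃ adds η = a₁ unless t = a₁, i.e. a₃ = 2a₁ + a₂.
-- Adjoining a later element c > a₃ turns M − 2η into M + c − 2(c + η), which keeps the sums
-- found so far distinct, and into M + c − 2η, which is new when η is small (η < c); the small η
-- form a family that grows by one at each step.  So the i-th step adds 5 + i sums (6 + i if
-- t ≠ a₁), and summing gives the first bound.  The same count starting from the empty set gives
-- |h^∧_± A₁| ≥ h(h+1)/2 + 1, and with it the second bound.
module Submission where

open import Defs
open import Data.Nat using (ℕ; _+_; _*_; _∸_; _/_; _≤_; _<_; _%_)
open import Data.Integer using (+_)
open import Data.List using (List; _∷_; map; length)
open import Data.List.Relation.Unary.AllPairs using (AllPairs)
open import Data.Product using (_×_)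
open import Relation.Binary.PropositionalEquality using (_≡_; _≢_)

open import Data.Integer as ℤ using (ℤ; -_)
open import Data.Integer.Properties as ℤ using ()
open import Data.Integer.Tactic.RingSolver using (solve-∀)
open import Data.List using ([]; _++_; deduplicate)
open import Data.List.Membership.Propositional using (_∈_; _∉_)
open import Data.List.Membership.Propositional.Properties
  using (∈-++⁺ˡ; ∈-++⁺ʳ; ∈-++⁻; ∈-map⁺; ∈-map⁻; ∈-∃++; ∈-deduplicate⁺; ∈-deduplicate⁻)
open import Data.List.Properties as List using ()
open import Data.List.Relation.Binary.Disjoint.Propositional using (Disjoint)
open import Data.List.Relation.Binary.Subset.Propositional using (_⊆_)
open import Data.List.Relation.Unary.All as All using (All; []; _∷_)
import Data.List.Relation.Unary.All.Properties as All
import Data.List.Relation.Unary.AllPairs as AllPairs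
open import Data.List.Relation.Unary.AllPairs using ([]; _∷_)
open import Data.List.Relation.Unary.Any using (here; there)
open import Data.List.Relation.Unary.Linked using (Linked; [-]; _∷_)
open import Data.List.Relation.Unary.Linked.Properties using (Linked⇒All; Linked⇒AllPairs)
open import Data.List.Relation.Unary.Unique.Propositional using (Unique)
import Data.List.Relation.Unary.Unique.Propositional.Properties as Unique
open import Data.List.Relation.Unary.Unique.DecPropositional.Properties ℤ._≟_ using (deduplicate-!)
open import Data.Nat using (zero; suc; _>_; z≤n; s≤s; ⌊_/2⌋)
open import Data.Nat.DivMod using (m%n<n; [m+kn]%n≡m%n; m*n/n≡m)
open import Data.Nat.ListAction using (sum)
open import Data.Nat.Properties as ℕ using ()
import Data.Nat.Tactic.RingSolver as ℕ-Solver
open import Data.Product using (∃-syntax; _,_; proj₁; proj₂)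
open import Data.Sum using (_⊎_; inj₁; inj₂)
open import Function using (_∘_)
open import Relation.Binary.PropositionalEquality using (refl; sym; trans; cong; subst; module ≡-Reasoning)
open import Relation.Nullary using (contradiction)

module _ (a : ℤ) (as : List ℤ) where

  ∈-signedSums-skip : ∀ {k x} → x ∈ signedSums as k → x ∈ signedSums (a ∷ as) k
  ∈-signedSums-skip {zero}  x∈ = x∈
  ∈-signedSums-skip {suc k} x∈ = ∈-++⁺ˡ x∈

  ∈-signedSums-pos : ∀ {k x} → x ∈ signedSums as k → a ℤ.+ x ∈ signedSums (a ∷ as) (suc k)
  ∈-signedSums-pos {k} x∈ = ∈-++⁺ʳ (signedSums as (suc k)) (∈-++⁺ˡ (∈-map⁺ (λ s → a ℤ.+ s) x∈))

  ∈-signedSums-neg : ∀ {k x} → x ∈ signedSums as k → - a ℤ.+ x ∈ signedSums (a ∷ as) (suc k)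
  ∈-signedSums-neg {k} x∈ = ∈-++⁺ʳ (signedSums as (suc k))
    (∈-++⁺ʳ (map (λ s → a ℤ.+ s) (signedSums as k)) (∈-map⁺ (λ s → - a ℤ.+ s) x∈))

  ∈-signedSums-∷⁻ : ∀ {k x} → x ∈ signedSums (a ∷ as) (suc k) →
                    x ∈ signedSums as (suc k) ⊎ ∃[ y ] y ∈ signedSums as k × (x ≡ a ℤ.+ y ⊎ x ≡ - a ℤ.+ y)
  ∈-signedSums-∷⁻ {k} x∈ with ∈-++⁻ (signedSums as (suc k)) x∈
  ... | inj₁ x∈skip = inj₁ x∈skip
  ... | inj₂ x∈± with ∈-++⁻ (map (λ s → a ℤ.+ s) (signedSums as k)) x∈±
  ... | inj₁ x∈pos = let y , y∈ , x≡ = ∈-map⁻ (λ s → a ℤ.+ s) x∈pos in inj₂ (y , y∈ , inj₁ x≡)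
  ... | inj₂ x∈neg = let y , y∈ , x≡ = ∈-map⁻ (λ s → - a ℤ.+ s) x∈neg in inj₂ (y , y∈ , inj₂ x≡)

∈-signedSums-++ : ∀ xs ys {k l x y} → x ∈ signedSums xs k → y ∈ signedSums ys l →
                  x ℤ.+ y ∈ signedSums (xs ++ ys) (k + l)
∈-signedSums-++ []       ys {zero}  (here refl) y∈ = subst (_∈ _) (sym (ℤ.+-identityˡ _)) y∈
∈-signedSums-++ (a ∷ xs) ys {zero}  x∈ y∈ = ∈-signedSums-skip a (xs ++ ys) (∈-signedSums-++ xs ys x∈ y∈)
∈-signedSums-++ (a ∷ xs) ys {suc k} {y = y} x∈ y∈ with ∈-signedSums-∷⁻ a xs x∈
... | inj₁ x∈skip = ∈-signedSums-skip a (xs ++ ys) (∈-signedSums-++ xs ys x∈skip y∈)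
... | inj₂ (x′ , x′∈ , inj₁ refl) = subst (_∈ _) (sym (ℤ.+-assoc a x′ y))
  (∈-signedSums-pos a (xs ++ ys) (∈-signedSums-++ xs ys x′∈ y∈))
... | inj₂ (x′ , x′∈ , inj₂ refl) = subst (_∈ _) (sym (ℤ.+-assoc (- a) x′ y))
  (∈-signedSums-neg a (xs ++ ys) (∈-signedSums-++ xs ys x′∈ y∈))

∉-signedSums-long : ∀ as {k x} → length as < k → x ∉ signedSums as k
∉-signedSums-long []       {suc k} _            ()
∉-signedSums-long (a ∷ as) {suc k} (s≤s |as|<k) x∈ with ∈-signedSums-∷⁻ a as x∈
... | inj₁ x∈skip       = ∉-signedSums-long as (ℕ.m<n⇒m<1+n |as|<k) x∈skip
... | inj₂ (y , y∈ , _) = ∉-signedSums-long as |as|<k y∈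

infixl 6 _-2·_

_-2·_ : ℕ → ℕ → ℤ
m -2· η = + m ℤ.- (+ η ℤ.+ + η)

∈-signedSums-full : ∀ as {x} → x ∈ signedSums (map +_ as) (length as) → ∃[ n ] x ≡ sum as -2· n
∈-signedSums-full []       (here refl) = 0 , refl
∈-signedSums-full (a ∷ as) x∈ with ∈-signedSums-∷⁻ (+ a) (map +_ as) x∈
... | inj₁ x∈long = contradiction x∈long
  (∉-signedSums-long (map +_ as) (ℕ.≤-reflexive (cong suc (List.length-map +_ as))))
... | inj₂ (y , y∈ , inj₁ refl) with n , refl ← ∈-signedSums-full as y∈ =
  n , add (+ a) (+ sum as) (+ n)
  where
  add : ∀ a s n → a ℤ.+ (s ℤ.- (n ℤ.+ n)) ≡ (a ℤ.+ s) ℤ.- (n ℤ.+ n)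
  add = solve-∀
... | inj₂ (y , y∈ , inj₂ refl) with n , refl ← ∈-signedSums-full as y∈ =
  a + n , sub (+ a) (+ sum as) (+ n)
  where
  sub : ∀ a s n → - a ℤ.+ (s ℤ.- (n ℤ.+ n)) ≡ (a ℤ.+ s) ℤ.- ((a ℤ.+ n) ℤ.+ (a ℤ.+ n))
  sub = solve-∀

-2·-≡⇒+-≡ : ∀ {m n η ζ} → m -2· η ≡ n -2· ζ → m + (ζ + ζ) ≡ n + (η + η)
-2·-≡⇒+-≡ {m} {n} {η} {ζ} eq = ℤ.+-injective (begin
  + m ℤ.+ (+ ζ ℤ.+ + ζ)                          ≡⟨ cancel (+ m) (+ η) (+ ζ) ⟨
  m -2· η ℤ.+ ((+ η ℤ.+ + η) ℤ.+ (+ ζ ℤ.+ + ζ))  ≡⟨ cong (ℤ._+ ((+ η ℤ.+ + η) ℤ.+ (+ ζ ℤ.+ + ζ))) eq ⟩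
  n -2· ζ ℤ.+ ((+ η ℤ.+ + η) ℤ.+ (+ ζ ℤ.+ + ζ))  ≡⟨ cancel′ (+ n) (+ η) (+ ζ) ⟩
  + n ℤ.+ (+ η ℤ.+ + η)                          ∎)
  where
  open ≡-Reasoning
  cancel : ∀ m e z → (m ℤ.- (e ℤ.+ e)) ℤ.+ ((e ℤ.+ e) ℤ.+ (z ℤ.+ z)) ≡ m ℤ.+ (z ℤ.+ z)
  cancel = solve-∀
  cancel′ : ∀ n e z → (n ℤ.- (z ℤ.+ z)) ℤ.+ ((e ℤ.+ e) ℤ.+ (z ℤ.+ z)) ≡ n ℤ.+ (e ℤ.+ e)
  cancel′ = solve-∀

-2·-injectiveʳ : ∀ {m η ζ} → m -2· η ≡ m -2· ζ → η ≡ ζ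
-2·-injectiveʳ {m} {η} {ζ} eq = begin
  η            ≡⟨ ℕ.n≡⌊n+n/2⌋ η ⟩
  ⌊ η + η /2⌋  ≡⟨ cong ⌊_/2⌋ (ℕ.+-cancelˡ-≡ m _ _ (-2·-≡⇒+-≡ {m} {m} {η} {ζ} eq)) ⟨
  ⌊ ζ + ζ /2⌋  ≡⟨ ℕ.n≡⌊n+n/2⌋ ζ ⟨
  ζ            ∎
  where open ≡-Reasoning

+-double-%2 : ∀ m n → (m + (n + n)) % 2 ≡ m % 2
+-double-%2 m n = trans (cong (λ d → (m + d) % 2) (double n)) ([m+kn]%n≡m%n m n 2)
  where
  double : ∀ n → n + n ≡ n * 2
  double = ℕ-Solver.solve-∀

-2·-parity : ∀ a b r {η ζ} → (a + r) -2· η ≡ (b + r) -2· ζ → a % 2 ≡ b % 2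
-2·-parity a b r {η} {ζ} eq = begin
  a % 2              ≡⟨ +-double-%2 a ζ ⟨
  (a + (ζ + ζ)) % 2  ≡⟨ cong (_% 2) (ℕ.+-cancelʳ-≡ r _ _ (begin
    a + (ζ + ζ) + r    ≡⟨ swap a r ζ ⟩
    a + r + (ζ + ζ)    ≡⟨ -2·-≡⇒+-≡ {a + r} {b + r} {η} {ζ} eq ⟩
    b + r + (η + η)    ≡⟨ swap b r η ⟨
    b + (η + η) + r    ∎)) ⟩
  (b + (η + η)) % 2  ≡⟨ +-double-%2 b η ⟩
  b % 2              ∎
  where
  open ≡-Reasoning
  swap : ∀ a r z → a + (z + z) + r ≡ a + r + (z + z)
  swap = ℕ-Solver.solve-∀

suc-%2-≢ : ∀ m → suc m % 2 ≢ m % 2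
suc-%2-≢ zero          ()
suc-%2-≢ (suc zero)    ()
suc-%2-≢ (suc (suc m)) = suc-%2-≢ m

even-gap : ∀ d m → (d + m) % 2 ≡ m % 2 → ∃[ t ] d ≡ t + t
even-gap zero          m _  = 0 , refl
even-gap (suc zero)    m eq = contradiction eq (suc-%2-≢ m)
even-gap (suc (suc d)) m eq with t , refl ← even-gap d m eq = suc t , cong suc (sym (ℕ.+-suc t t))

same-parity⇒gap : ∀ {m n} → m % 2 ≡ n % 2 → m < n → ∃[ t ] 0 < t × n ≡ m + (t + t)
same-parity⇒gap {m} m≡n m<n with o , refl ← ℕ.m≤n⇒∃[o]m+o≡n m<n
  with even-gap (suc o) m (trans (cong (λ x → suc x % 2) (ℕ.+-comm o m)) (sym m≡n))
... | suc t , o≡ = suc t , s≤s z≤n , trans (sym (ℕ.+-suc m o)) (cong (λ d → m + d) o≡)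

≢-bit⇒≡1∸ : ∀ {a b} → a < 2 → b < 2 → a ≢ b → b ≡ 1 ∸ a
≢-bit⇒≡1∸ {0} {0} _ _ a≢b = contradiction refl a≢b
≢-bit⇒≡1∸ {0} {1} _ _ _   = refl
≢-bit⇒≡1∸ {1} {0} _ _ _   = refl
≢-bit⇒≡1∸ {1} {1} _ _ a≢b = contradiction refl a≢b
≢-bit⇒≡1∸ {suc (suc _)} (s≤s (s≤s ())) _ _
≢-bit⇒≡1∸ {_} {suc (suc _)} _ (s≤s (s≤s ())) _

%2-≢-≢⇒≡ : ∀ a b c → a % 2 ≢ b % 2 → a % 2 ≢ c % 2 → b % 2 ≡ c % 2
%2-≢-≢⇒≡ a b c a≢b a≢c =
  trans (≢-bit⇒≡1∸ (m%n<n a 2) (m%n<n b 2) a≢b) (sym (≢-bit⇒≡1∸ (m%n<n a 2) (m%n<n c 2) a≢c))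

∈-++-∷⁻ : ∀ {A : Set} (us : List A) {vs x y} → y ∈ us ++ x ∷ vs → y ≢ x → y ∈ us ++ vs
∈-++-∷⁻ us y∈ y≢x with ∈-++⁻ us y∈
... | inj₁ y∈us         = ∈-++⁺ˡ y∈us
... | inj₂ (here y≡x)   = contradiction y≡x y≢x
... | inj₂ (there y∈vs) = ∈-++⁺ʳ us y∈vs

length-++-∷ : ∀ {A : Set} (us : List A) {vs x} → length (us ++ x ∷ vs) ≡ suc (length (us ++ vs))
length-++-∷ us {vs} = begin
  length (us ++ _ ∷ vs)        ≡⟨ List.length-++ us ⟩
  length us + suc (length vs)  ≡⟨ ℕ.+-suc (length us) (length vs) ⟩
  suc (length us + length vs)  ≡⟨ cong suc (List.length-++ us) ⟨
  suc (length (us ++ vs))      ∎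
  where open ≡-Reasoning

Unique⇒length≤ : ∀ {A : Set} {xs ys : List A} → Unique xs → xs ⊆ ys → length xs ≤ length ys
Unique⇒length≤ [] _ = z≤n
Unique⇒length≤ {xs = x ∷ xs} (x∉xs ∷ xs!) xs⊆ys with us , vs , refl ← ∈-∃++ (xs⊆ys (here refl)) =
  subst (suc (length xs) ≤_) (sym (length-++-∷ us)) (s≤s (Unique⇒length≤ xs! xs⊆us++vs))
  where
  xs⊆us++vs : xs ⊆ us ++ vs
  xs⊆us++vs y∈xs = ∈-++-∷⁻ us (xs⊆ys (there y∈xs)) (λ { refl → All.lookup x∉xs y∈xs refl })

Unique⇒length≤deduplicate : ∀ {xs ys} → Unique xs → All (_∈ ys) xs → length xs ≤ length (deduplicate ℤ._≟_ ys)
Unique⇒length≤deduplicate xs! xs⊆ys = Unique⇒length≤ xs! (∈-deduplicate⁺ ℤ._≟_ ∘ All.lookup xs⊆ys)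

Linked>⇒Unique : ∀ {xs} → Linked _>_ xs → Unique xs
Linked>⇒Unique = AllPairs.map ℕ.>⇒≢ ∘ Linked⇒AllPairs (λ x>y y>z → ℕ.<-trans y>z x>y)

triangle : ℕ → ℕ
triangle zero    = 0
triangle (suc n) = suc n + triangle n

triangle-double : ∀ n → triangle n * 2 ≡ n * (n + 1)
triangle-double zero    = refl
triangle-double (suc n) = begin
  (suc n + triangle n) * 2    ≡⟨ distrib (suc n) (triangle n) ⟩
  suc n * 2 + triangle n * 2  ≡⟨ cong (λ x → suc n * 2 + x) (triangle-double n) ⟩
  suc n * 2 + n * (n + 1)     ≡⟨ regroup n ⟩
  suc n * (suc n + 1)         ∎
  where
  open ≡-Reasoning
  distrib : ∀ m t → (m + t) * 2 ≡ m * 2 + t * 2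
  distrib = ℕ-Solver.solve-∀
  regroup : ∀ n → suc n * 2 + n * (n + 1) ≡ suc n * (suc n + 1)
  regroup = ℕ-Solver.solve-∀

triangle≡half : ∀ n → (n * (n + 1)) / 2 ≡ triangle n
triangle≡half n = trans (cong (_/ 2) (sym (triangle-double n))) (m*n/n≡m (triangle n) 2)

record Spread (T : ℤ → Set) (M : ℕ) (L : List ℕ) : Set where
  constructor mkSpread
  field
    unique : Unique L
    valid  : All (λ η → T (M -2· η)) L

module _ {T : ℤ → Set} {M : ℕ} {L : List ℕ} (spread : Spread T M L) where

  Spread⇒Unique : Unique (map (M -2·_) L)
  Spread⇒Unique = Unique.map⁺ -2·-injectiveʳ (Spread.unique spread)

  Spread⇒All : All T (map (M -2·_) L)
  Spread⇒All = All.map⁺ (Spread.valid spread)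

Spread-resp : ∀ {xs ys k l M N L} → xs ≡ ys → k ≡ l → M ≡ N →
              Spread (_∈ signedSums xs k) M L → Spread (_∈ signedSums ys l) N L
Spread-resp refl refl refl spread = spread

-- L indexes the values M − 2η counted so far; S indexes those that remain usable unshifted,
-- as M + c − 2η, once a summand c larger than all of S is adjoined (see Chain-step).
record Chain (T : ℤ → Set) (M : ℕ) (L S : List ℕ) : Set where
  field
    L-spread : Spread T M L
    S-spread : Spread T M S
    top      : T (+ M)

Chain-step : ∀ {T T′ M L S} c → (∀ {x} → T x → T′ (x ℤ.+ + c)) → (∀ {x} → T x → T′ (x ℤ.- + c)) →
             All (_< c) S → Chain T M L S → Chain T′ (M + c) (map (λ η → c + η) L ++ S) (c ∷ S)
Chain-step {T} {T′} {M} {L} {S} c T+c T-c S<c chain = record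
  { L-spread = mkSpread
      (Unique.++⁺ (Unique.map⁺ (ℕ.+-cancelˡ-≡ c _ _) (unique L-spread)) (unique S-spread) shifted∉S)
      (All.++⁺ (All.map⁺ (All.map (λ {η} → shift {η}) (valid L-spread))) (All.map (λ {η} → keep {η}) (valid S-spread)))
  ; S-spread = mkSpread (All.map ℕ.>⇒≢ S<c ∷ unique S-spread) (new ∷ All.map (λ {η} → keep {η}) (valid S-spread))
  ; top      = T+c top
  }
  where
  open Chain chain
  open Spread
  keep : ∀ {η} → T (M -2· η) → T′ ((M + c) -2· η)
  keep {η} = subst T′ (regroup (+ M) (+ η) (+ c)) ∘ T+c
    where
    regroup : ∀ m e c → (m ℤ.- (e ℤ.+ e)) ℤ.+ c ≡ (m ℤ.+ c) ℤ.- (e ℤ.+ e)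
    regroup = solve-∀
  shift : ∀ {η} → T (M -2· η) → T′ ((M + c) -2· (c + η))
  shift {η} = subst T′ (regroup (+ M) (+ η) (+ c)) ∘ T-c
    where
    regroup : ∀ m e c → (m ℤ.- (e ℤ.+ e)) ℤ.- c ≡ (m ℤ.+ c) ℤ.- ((c ℤ.+ e) ℤ.+ (c ℤ.+ e))
    regroup = solve-∀
  new : T′ ((M + c) -2· c)
  new = subst T′ (regroup (+ M) (+ c)) (T-c top)
    where
    regroup : ∀ m c → m ℤ.- c ≡ (m ℤ.+ c) ℤ.- (c ℤ.+ c)
    regroup = solve-∀
  shifted∉S : Disjoint (map (λ η → c + η) L) S
  shifted∉S (v∈shifted , v∈S) with η , _ , refl ← ∈-map⁻ (λ η → c + η) v∈shifted =
    ℕ.<⇒≱ (All.lookup S<c v∈S) (ℕ.m≤m+n c η)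

Chain-extend : ∀ {xs k M L S} cs → AllPairs _<_ cs → All (λ c → All (_< c) S) cs →
               Chain (_∈ signedSums xs k) M L S →
               ∃[ L′ ] Spread (_∈ signedSums (xs ++ map +_ cs) (k + length cs)) (M + sum cs) L′
                     × length L′ + length cs ≡ length L + length cs * length S + triangle (length cs)
Chain-extend {xs} {k} {M} {L} [] [] [] chain =
  L , Spread-resp (sym (List.++-identityʳ xs)) (sym (ℕ.+-identityʳ k)) (sym (ℕ.+-identityʳ M)) (Chain.L-spread chain)
    , sym (ℕ.+-identityʳ (length L + 0))
Chain-extend {xs} {k} {M} {L} {S} (c ∷ cs) (c<cs ∷ cs↑) (S<c ∷ S<cs) chain =
  let L′ , spread , |L′| = Chain-extend {xs ++ + c ∷ []} {k + 1} cs cs↑ c∷S<cs (Chain-step c add sub S<c chain)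
  in L′ , Spread-resp (List.++-assoc xs (+ c ∷ []) (map +_ cs)) (ℕ.+-assoc k 1 n) (ℕ.+-assoc M c (sum cs)) spread
        , (begin
          length L′ + suc n                              ≡⟨ ℕ.+-suc (length L′) n ⟩
          suc (length L′ + n)                            ≡⟨ cong suc |L′| ⟩
          suc (length L₁ + n * suc s + triangle n)       ≡⟨ cong (λ l → suc (l + n * suc s + triangle n)) |L₁| ⟩
          suc (length L + s + n * suc s + triangle n)    ≡⟨ regroup (length L) s n (triangle n) ⟩
          length L + suc n * s + triangle (suc n)        ∎)
  where
  open ≡-Reasoning
  n = length cs
  s = length S
  L₁ = map (λ η → c + η) L ++ S
  |L₁| : length L₁ ≡ length L + s
  |L₁| = trans (List.length-++ (map (λ η → c + η) L)) (cong (λ l → l + s) (List.length-map (λ η → c + η) L))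
  add : ∀ {x} → x ∈ signedSums xs k → x ℤ.+ + c ∈ signedSums (xs ++ + c ∷ []) (k + 1)
  add x∈ = ∈-signedSums-++ xs (+ c ∷ []) x∈ (here (sym (ℤ.+-identityʳ (+ c))))
  sub : ∀ {x} → x ∈ signedSums xs k → x ℤ.- + c ∈ signedSums (xs ++ + c ∷ []) (k + 1)
  sub x∈ = ∈-signedSums-++ xs (+ c ∷ []) x∈ (there (here (sym (ℤ.+-identityʳ (- + c)))))
  c∷S<cs : All (λ c′ → All (_< c′) (c ∷ S)) cs
  c∷S<cs = All.zipWith (λ (c<c′ , S<c′) → c<c′ ∷ S<c′) (c<cs , S<cs)
  regroup : ∀ l s n t → suc (l + s + n * suc s + t) ≡ l + suc n * s + (suc n + t)
  regroup = ℕ-Solver.solve-∀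

restrictedSignedSumsetSize-full-≥ : ∀ as → AllPairs _<_ as → All (0 <_) as →
                                    1 + triangle (length as) ≤ restrictedSignedSumsetSize (length as) (map +_ as)
restrictedSignedSumsetSize-full-≥ as as↑ as>0 =
  let L , spread , |L| = Chain-extend {[]} {0} as as↑ (All.map (_∷ []) as>0) origin
  in begin
    1 + triangle n                               ≡⟨ ℕ.+-cancelʳ-≡ n _ _ (trans (regroup n (triangle n)) (sym |L|)) ⟩
    length L                                     ≡⟨ List.length-map (sum as -2·_) L ⟨
    length (map (sum as -2·_) L)                 ≤⟨ Unique⇒length≤deduplicate (Spread⇒Unique spread) (Spread⇒All spread) ⟩
    restrictedSignedSumsetSize n (map +_ as)     ∎
  where
  open ℕ.≤-Reasoning
  n = length as
  origin : Chain (_∈ signedSums [] 0) 0 (0 ∷ []) (0 ∷ [])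
  origin = record
    { L-spread = mkSpread ([] ∷ []) (here refl ∷ [])
    ; S-spread = mkSpread ([] ∷ []) (here refl ∷ [])
    ; top      = here refl
    }
  regroup : ∀ n t → 1 + t + n ≡ 1 + n * 1 + t
  regroup = ℕ-Solver.solve-∀

chain-length⇒ : ∀ k m {ℓ} → ℓ + m ≡ (5 + k) + m * (4 + k) + triangle m →
                ℓ + k ≡ triangle (2 + m) + (k + 1) * (2 + m)
chain-length⇒ k m {ℓ} eq = ℕ.+-cancelʳ-≡ m _ _ (begin
  ℓ + k + m                                 ≡⟨ swap ℓ k m ⟩
  ℓ + m + k                                 ≡⟨ cong (λ x → x + k) eq ⟩
  5 + k + m * (4 + k) + triangle m + k      ≡⟨ regroup k m (triangle m) ⟩
  triangle (2 + m) + (k + 1) * (2 + m) + m  ∎)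
  where
  open ≡-Reasoning
  swap : ∀ l k m → l + k + m ≡ l + m + k
  swap = ℕ-Solver.solve-∀
  regroup : ∀ k m t → 5 + k + m * (4 + k) + t + k ≡ suc (suc m) + (suc m + t) + (k + 1) * suc (suc m) + m
  regroup = ℕ-Solver.solve-∀

bounds : ∀ k h {N N₁ ℓ} → 1 + triangle h ≤ N₁ → N₁ + ℓ ≤ N → ℓ + k ≡ triangle h + (k + 1) * h →
         (N₁ + (h * (h + 1)) / 2 + (k + 1) * h ∸ k ≤ N) × (suc (h * h + (k + 2) * h) ∸ k ≤ N)
bounds k h {N} {N₁} {ℓ} 1+T≤N₁ N₁+ℓ≤N ℓ+k≡ = first , second
  where
  open ℕ.≤-Reasoning
  T = triangle h
  first : N₁ + (h * (h + 1)) / 2 + (k + 1) * h ∸ k ≤ N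
  first = begin
    N₁ + (h * (h + 1)) / 2 + (k + 1) * h ∸ k  ≡⟨ cong (λ x → N₁ + x + (k + 1) * h ∸ k) (triangle≡half h) ⟩
    N₁ + T + (k + 1) * h ∸ k                  ≡⟨ cong (_∸ k) (ℕ.+-assoc N₁ T _) ⟩
    N₁ + (T + (k + 1) * h) ∸ k                ≡⟨ cong (λ x → N₁ + x ∸ k) ℓ+k≡ ⟨
    N₁ + (ℓ + k) ∸ k                          ≡⟨ cong (_∸ k) (ℕ.+-assoc N₁ ℓ k) ⟨
    N₁ + ℓ + k ∸ k                            ≡⟨ ℕ.m+n∸n≡m (N₁ + ℓ) k ⟩
    N₁ + ℓ                                    ≤⟨ N₁+ℓ≤N ⟩
    N                                         ∎
  second : suc (h * h + (k + 2) * h) ∸ k ≤ N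
  second = begin
    suc (h * h + (k + 2) * h) ∸ k        ≡⟨ cong (_∸ k) (regroup h k) ⟩
    suc (h * (h + 1) + (k + 1) * h) ∸ k  ≡⟨ cong (λ x → suc (x + (k + 1) * h) ∸ k) (triangle-double h) ⟨
    suc (T * 2 + (k + 1) * h) ∸ k        ≡⟨ cong (_∸ k) (split T ((k + 1) * h)) ⟩
    suc (T + (T + (k + 1) * h)) ∸ k      ≡⟨ cong (λ x → suc (T + x) ∸ k) ℓ+k≡ ⟨
    suc (T + (ℓ + k)) ∸ k                ≡⟨ cong (λ x → suc x ∸ k) (ℕ.+-assoc T ℓ k) ⟨
    suc (T + ℓ) + k ∸ k                  ≡⟨ ℕ.m+n∸n≡m (suc (T + ℓ)) k ⟩
    1 + T + ℓ                            ≤⟨ ℕ.+-monoˡ-≤ ℓ 1+T≤N₁ ⟩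
    N₁ + ℓ                               ≤⟨ N₁+ℓ≤N ⟩
    N                                    ∎
    where
    regroup : ∀ h k → suc (h * h + (k + 2) * h) ≡ suc (h * (h + 1) + (k + 1) * h)
    regroup = ℕ-Solver.solve-∀
    split : ∀ t x → suc (t * 2 + x) ≡ suc (t + (t + x))
    split = ℕ-Solver.solve-∀

module Extension (a₁ a₂ t : ℕ) (rest : List ℕ) (0<a₁ : 0 < a₁) (0<t : 0 < t)
                 (a₁<A₁ : All (a₁ <_) (a₂ ∷ a₂ + (t + t) ∷ rest))
                 (A₁↑ : AllPairs _<_ (a₂ ∷ a₂ + (t + t) ∷ rest))
                 (a₁≢a₂ : a₁ % 2 ≢ a₂ % 2) where

  a₃ m R : ℕ
  a₃ = a₂ + (t + t)
  m  = length rest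
  R  = sum rest

  N N₁ : ℕ
  N  = restrictedSignedSumsetSize (2 + m) (map +_ (a₁ ∷ a₂ ∷ a₃ ∷ rest))
  N₁ = restrictedSignedSumsetSize (2 + m) (map +_ (a₂ ∷ a₃ ∷ rest))

  1+triangle≤N₁ : 1 + triangle (2 + m) ≤ N₁
  1+triangle≤N₁ = restrictedSignedSumsetSize-full-≥ (a₂ ∷ a₃ ∷ rest) A₁↑ (All.map (ℕ.<-trans 0<a₁) a₁<A₁)

  M₀ : ℕ
  M₀ = a₁ + a₃

  Base : ℤ → Set
  Base = _∈ signedSums (+ a₁ ∷ + a₂ ∷ + a₃ ∷ []) 2

  ±a₁ : ∀ η {y} → y ∈ signedSums (+ a₂ ∷ + a₃ ∷ []) 1 → M₀ -2· η ≡ + a₁ ℤ.+ y →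
        Base (M₀ -2· η) × Base (M₀ -2· (η + a₁))
  ±a₁ η {y} y∈ eq = subst Base (sym eq) (∈-signedSums-pos (+ a₁) (+ a₂ ∷ + a₃ ∷ []) {1} y∈)
                  , subst Base (sym flip) (∈-signedSums-neg (+ a₁) (+ a₂ ∷ + a₃ ∷ []) {1} y∈)
    where
    open ≡-Reasoning
    flip : M₀ -2· (η + a₁) ≡ - + a₁ ℤ.+ y
    flip = begin
      M₀ -2· (η + a₁)                   ≡⟨ peel (+ M₀) (+ η) (+ a₁) ⟩
      M₀ -2· η ℤ.- (+ a₁ ℤ.+ + a₁)      ≡⟨ cong (ℤ._- (+ a₁ ℤ.+ + a₁)) eq ⟩
      (+ a₁ ℤ.+ y) ℤ.- (+ a₁ ℤ.+ + a₁)  ≡⟨ negate (+ a₁) y ⟩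
      - + a₁ ℤ.+ y                      ∎
      where
      peel : ∀ m e a → m ℤ.- ((e ℤ.+ a) ℤ.+ (e ℤ.+ a)) ≡ (m ℤ.- (e ℤ.+ e)) ℤ.- (a ℤ.+ a)
      peel = solve-∀
      negate : ∀ a y → (a ℤ.+ y) ℤ.- (a ℤ.+ a) ≡ - a ℤ.+ y
      negate = solve-∀

  ±a₁+a₃ : Base (M₀ -2· 0) × Base (M₀ -2· a₁)
  ±a₁+a₃ = ±a₁ 0 (∈-signedSums-skip (+ a₂) (+ a₃ ∷ []) {1} (∈-signedSums-pos (+ a₃) [] {0} (here refl)))
                 (regroup (+ a₁) (+ a₃))
    where
    regroup : ∀ a c → (a ℤ.+ c) ℤ.- (+ 0 ℤ.+ + 0) ≡ a ℤ.+ (c ℤ.+ + 0)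
    regroup = solve-∀

  ±a₁-a₃ : Base (M₀ -2· a₃) × Base (M₀ -2· (a₃ + a₁))
  ±a₁-a₃ = ±a₁ a₃ (∈-signedSums-skip (+ a₂) (+ a₃ ∷ []) {1} (∈-signedSums-neg (+ a₃) [] {0} (here refl)))
                  (regroup (+ a₁) (+ a₃))
    where
    regroup : ∀ a c → (a ℤ.+ c) ℤ.- (c ℤ.+ c) ≡ a ℤ.+ (- c ℤ.+ + 0)
    regroup = solve-∀

  ±a₁+a₂ : Base (M₀ -2· t) × Base (M₀ -2· (t + a₁))
  ±a₁+a₂ = ±a₁ t (∈-signedSums-pos (+ a₂) (+ a₃ ∷ []) {0} (here refl)) (regroup (+ a₁) (+ a₂) (+ t))
    where
    regroup : ∀ a b t → (a ℤ.+ (b ℤ.+ (t ℤ.+ t))) ℤ.- (t ℤ.+ t) ≡ a ℤ.+ (b ℤ.+ + 0)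
    regroup = solve-∀

  ±a₁-a₂ : Base (M₀ -2· (a₂ + t)) × Base (M₀ -2· (a₂ + t + a₁))
  ±a₁-a₂ = ±a₁ (a₂ + t) (∈-signedSums-neg (+ a₂) (+ a₃ ∷ []) {0} (here refl)) (regroup (+ a₁) (+ a₂) (+ t))
    where
    regroup : ∀ a b t → (a ℤ.+ (b ℤ.+ (t ℤ.+ t))) ℤ.- ((b ℤ.+ t) ℤ.+ (b ℤ.+ t)) ≡ a ℤ.+ (- b ℤ.+ + 0)
    regroup = solve-∀

  a₁<a₂ : a₁ < a₂
  a₁<a₂ = All.head a₁<A₁

  t<t+a₁ : t < t + a₁
  t<t+a₁ = ℕ.m<m+n t 0<a₁

  t+a₁<a₂+t : t + a₁ < a₂ + t
  t+a₁<a₂+t = subst (t + a₁ <_) (ℕ.+-comm t a₂) (ℕ.+-monoʳ-< t a₁<a₂)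

  a₂+t<a₃ : a₂ + t < a₃
  a₂+t<a₃ = ℕ.+-monoʳ-< a₂ (ℕ.m<m+n t 0<t)

  a₂+t<a₂+t+a₁ : a₂ + t < a₂ + t + a₁
  a₂+t<a₂+t+a₁ = ℕ.m<m+n (a₂ + t) 0<a₁

  a₂+t+a₁<a₃+a₁ : a₂ + t + a₁ < a₃ + a₁
  a₂+t+a₁<a₃+a₁ = ℕ.+-monoˡ-< a₁ a₂+t<a₃

  a₁<a₂+t : a₁ < a₂ + t
  a₁<a₂+t = ℕ.<-≤-trans a₁<a₂ (ℕ.m≤m+n a₂ t)

  tail₀ L₀ S₀ : List ℕ
  tail₀ = a₂ + t ∷ t + a₁ ∷ t ∷ 0 ∷ []
  L₀    = a₃ + a₁ ∷ a₂ + t + a₁ ∷ tail₀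
  S₀    = a₃ ∷ tail₀

  tail₀↓ : Linked _>_ tail₀
  tail₀↓ = t+a₁<a₂+t ∷ t<t+a₁ ∷ 0<t ∷ [-]

  base : Chain Base M₀ L₀ S₀
  base = record
    { L-spread = mkSpread (Linked>⇒Unique (a₂+t+a₁<a₃+a₁ ∷ a₂+t<a₂+t+a₁ ∷ tail₀↓))
        (proj₂ ±a₁-a₃ ∷ proj₂ ±a₁-a₂ ∷ proj₁ ±a₁-a₂ ∷ proj₂ ±a₁+a₂ ∷ proj₁ ±a₁+a₂ ∷ proj₁ ±a₁+a₃ ∷ [])
    ; S-spread = mkSpread (Linked>⇒Unique (a₂+t<a₃ ∷ tail₀↓))
        (proj₁ ±a₁-a₃ ∷ proj₁ ±a₁-a₂ ∷ proj₂ ±a₁+a₂ ∷ proj₁ ±a₁+a₂ ∷ proj₁ ±a₁+a₃ ∷ [])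
    ; top      = subst Base (ℤ.+-identityʳ (+ M₀)) (proj₁ ±a₁+a₃)
    }

  base+a₁ : a₁ ≢ t → Chain Base M₀ (a₁ ∷ L₀) (a₁ ∷ S₀)
  base+a₁ a₁≢t = record
    { L-spread = mkSpread (a₁∉L₀ ∷ unique L-spread) (proj₂ ±a₁+a₃ ∷ valid L-spread)
    ; S-spread = mkSpread (a₁∉S₀ ∷ unique S-spread) (proj₂ ±a₁+a₃ ∷ valid S-spread)
    ; top      = top
    }
    where
    open Chain base
    open Spread
    a₁∉tail₀ : All (a₁ ≢_) tail₀
    a₁∉tail₀ = ℕ.<⇒≢ a₁<a₂+t ∷ ℕ.<⇒≢ (ℕ.m<n+m a₁ 0<t) ∷ a₁≢t ∷ ℕ.>⇒≢ 0<a₁ ∷ []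
    a₁∉L₀ : All (a₁ ≢_) L₀
    a₁∉L₀ = ℕ.<⇒≢ (ℕ.<-trans a₁<a₂+t (ℕ.<-trans a₂+t<a₂+t+a₁ a₂+t+a₁<a₃+a₁))
          ∷ ℕ.<⇒≢ (ℕ.<-trans a₁<a₂+t a₂+t<a₂+t+a₁) ∷ a₁∉tail₀
    a₁∉S₀ : All (a₁ ≢_) S₀
    a₁∉S₀ = ℕ.<⇒≢ (ℕ.<-trans a₁<a₂+t a₂+t<a₃) ∷ a₁∉tail₀

  S₀≤a₃ : All (_≤ a₃) S₀
  S₀≤a₃ = ℕ.≤-refl ∷ All.map ℕ.<⇒≤ (Linked⇒All (λ x>y y>z → ℕ.<-trans y>z x>y) a₂+t<a₃ tail₀↓)

  a₁∷S₀≤a₃ : All (_≤ a₃) (a₁ ∷ S₀)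
  a₁∷S₀≤a₃ = ℕ.<⇒≤ (ℕ.<-trans a₁<a₂+t a₂+t<a₃) ∷ S₀≤a₃

  N₁+spread≤N : ∀ {L} → Spread (_∈ signedSums (map +_ (a₁ ∷ a₂ ∷ a₃ ∷ rest)) (2 + m)) (M₀ + R) L →
                N₁ + length L ≤ N
  N₁+spread≤N {L} spread = subst (_≤ N) |Old++New|
    (Unique⇒length≤deduplicate (Unique.++⁺ (deduplicate-! Old) (Spread⇒Unique spread) Old∉New)
                               (All.++⁺ Old⊆ (Spread⇒All spread)))
    where
    Old New : List ℤ
    Old = signedSums (map +_ (a₂ ∷ a₃ ∷ rest)) (2 + m)
    New = map ((M₀ + R) -2·_) L
    Old⊆ : All (_∈ signedSums (map +_ (a₁ ∷ a₂ ∷ a₃ ∷ rest)) (2 + m)) (deduplicate ℤ._≟_ Old)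
    Old⊆ = All.tabulate (∈-signedSums-skip (+ a₁) (map +_ (a₂ ∷ a₃ ∷ rest)) {2 + m} ∘ ∈-deduplicate⁻ ℤ._≟_ Old)
    Old∉New : Disjoint (deduplicate ℤ._≟_ Old) New
    Old∉New (y∈Old , y∈New) with η , _ , refl ← ∈-map⁻ ((M₀ + R) -2·_) y∈New
                            with n , y≡ ← ∈-signedSums-full (a₂ ∷ a₃ ∷ rest) (∈-deduplicate⁻ ℤ._≟_ Old y∈Old) =
      a₁≢a₂ (-2·-parity a₁ a₂ (a₃ + R) {η} {n}
               (subst (λ M → M -2· η ≡ sum (a₂ ∷ a₃ ∷ rest) -2· n) (ℕ.+-assoc a₁ a₃ R) y≡))
    |Old++New| : length (deduplicate ℤ._≟_ Old ++ New) ≡ N₁ + length L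
    |Old++New| = trans (List.length-++ (deduplicate ℤ._≟_ Old)) (cong (λ l → N₁ + l) (List.length-map _ L))

  N₁+chain≤N : ∀ {L K} → Chain Base M₀ L K → All (_≤ a₃) K →
               ∃[ ℓ ] N₁ + ℓ ≤ N × ℓ + m ≡ length L + m * length K + triangle m
  N₁+chain≤N {L} {K} chain K≤a₃ =
    let L′ , spread , |L′| = Chain-extend {+ a₁ ∷ + a₂ ∷ + a₃ ∷ []} {2} rest rest↑ K<rest chain
    in length L′ , N₁+spread≤N spread , |L′|
    where
    rest↑ : AllPairs _<_ rest
    rest↑ = AllPairs.tail (AllPairs.tail A₁↑)
    K<rest : All (λ c → All (_< c) K) rest
    K<rest = All.map (λ a₃<c → All.map (λ η≤a₃ → ℕ.≤-<-trans η≤a₃ a₃<c) K≤a₃) (AllPairs.head (AllPairs.tail A₁↑))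

lemma5 : (h : ℕ) → 3 ≤ h →
    (a₁ a₂ a₃ : ℕ) → (rest : List ℕ) →
    length (a₁ ∷ a₂ ∷ a₃ ∷ rest) ≡ h + 1 →
    AllPairs _<_ (a₁ ∷ a₂ ∷ a₃ ∷ rest) →
    1 ≤ a₁ →
    a₁ % 2 ≢ a₂ % 2 →
    a₁ % 2 ≢ a₃ % 2 →
    let A  = map +_ (a₁ ∷ a₂ ∷ a₃ ∷ rest)
        A₁ = map +_ (a₂ ∷ a₃ ∷ rest)
        S  = restrictedSignedSumsetSize h A
        S₁ = restrictedSignedSumsetSize h A₁
    in (a₃ ≡ 2 * a₁ + a₂ →
          (S₁ + (h * (h + 1)) / 2 + 2 * h ∸ 1 ≤ S) × (h * h + 3 * h ≤ S))
     × (a₃ ≢ 2 * a₁ + a₂ →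
          (S₁ + (h * (h + 1)) / 2 + 3 * h ∸ 2 ≤ S) × (h * h + 4 * h ∸ 1 ≤ S))
lemma5 h _ a₁ a₂ a₃ rest |A|≡h+1 (a₁<A₁ ∷ A₁↑) 0<a₁ a₁≢a₂ a₁≢a₃
  with refl ← ℕ.suc-injective (trans |A|≡h+1 (ℕ.+-comm h 1))
  with t , 0<t , refl ← same-parity⇒gap (%2-≢-≢⇒≡ a₁ a₂ a₃ a₁≢a₂ a₁≢a₃) (All.head (AllPairs.head A₁↑)) =
  (λ _ → let ℓ , N₁+ℓ≤N , |ℓ| = N₁+chain≤N base S₀≤a₃
         in bounds 1 (2 + m) 1+triangle≤N₁ N₁+ℓ≤N (chain-length⇒ 1 m |ℓ|)) ,
  (λ a₃≢ → let ℓ , N₁+ℓ≤N , |ℓ| = N₁+chain≤N (base+a₁ (a₁≢t a₃≢)) a₁∷S₀≤a₃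
           in bounds 2 (2 + m) 1+triangle≤N₁ N₁+ℓ≤N (chain-length⇒ 2 m |ℓ|))
  where
  open Extension a₁ a₂ t rest 0<a₁ 0<t a₁<A₁ A₁↑ a₁≢a₂
  a₁≢t : a₂ + (t + t) ≢ 2 * a₁ + a₂ → a₁ ≢ t
  a₁≢t a₃≢ refl = a₃≢ (swap a₂ a₁)
    where
    swap : ∀ b a → b + (a + a) ≡ 2 * a + b
    swap = ℕ-Solver.solve-∀
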